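{- Let $\Lambda$ be a solid partition. Then $$\prod_{(i,j,k)\in\Lambda}V(i,j,k)\;\le\;\prod_{(i,j,k)\in\Lambda}V^\ast(i,j,k).$$
   Context: A solid partition $\Lambda$ is a finite subset of $\mathbb Z_{\ge0}^3$ that is a lower order ideal for the componentwise order: if $(i,j,k)\in\Lambda$ and $0\le p\le i$, $0\le q\le j$, $0\le r\le k$, then $(p,q,r)\in\Lambda$. For $(i,j,k)\in\Lambda$: $V(i,j,k)=|\{(p,q,r)\in\Lambda: i\le p,\ j\le q,\ k\le r\}|$ and $V^\ast(i,j,k)=|\{(p,q,r)\in\Lambda:p\le i,\ q\le j,\ r\le k\}|$. -}

module Defs where

open import Data.Nat using (ℕ; _≤_; _≤?_)
open import Data.Product using (_×_; _,_)
open import Data.List using (List; length; filter)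
open import Data.List.Membership.Propositional using (_∈_)
open import Data.List.Relation.Unary.Unique.Propositional using (Unique)
open import Relation.Nullary using (Dec)
open import Relation.Nullary.Decidable using (_×-dec_)

Point : Set
Point = ℕ × ℕ × ℕ

_≼_ : Point → Point → Set
(p , q , r) ≼ (i , j , k) = (p ≤ i) × (q ≤ j) × (r ≤ k)

_≼?_ : (x y : Point) → Dec (x ≼ y)
(p , q , r) ≼? (i , j , k) = (p ≤? i) ×-dec ((q ≤? j) ×-dec (r ≤? k))

record SolidPartition : Set where
  field
    cells  : List Point
    unique : Unique cells
    lower  : ∀ {x y} → y ∈ cells → x ≼ y → x ∈ cells
open SolidPartition public

V : SolidPartition → Point → ℕ
V Λ x = length (filter (x ≼?_) (cells Λ))

V* : SolidPartition → Point → ℕ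
V* Λ x = length (filter (_≼? x) (cells Λ))

-- Fix a coordinate direction. By downward closure, the cells of Λ in the
-- column through x in that direction have coordinates 0, …, h − 1, so
-- above(x) = h − (coordinate of x) counts the cells of the column at or
-- beyond x. Every cell y ≽ x therefore lies in the box
-- x + [0, above₁ x) × [0, above₂ x) × [0, above₃ x), so V(x) ≤ above₁ above₂ above₃.
-- Reversing every column permutes Λ and turns aboveₙ into (n-th coordinate + 1),
-- so ∏ above₁ above₂ above₃ = ∏ (i + 1)(j + 1)(k + 1). Finally the box
-- [0, i] × [0, j] × [0, k] lies in Λ below (i, j, k), so (i + 1)(j + 1)(k + 1) ≤ V*(i, j, k).
module Submission where

open import Defs
open import Data.Nat using (_≤_)
open import Data.List using (map)
open import Data.Nat.ListAction using (product)

open import Data.Nat using (ℕ; suc; _+_; _*_; _∸_; _<_; _≟_; _<?_; z≤n; s≤s; s≤s⁻¹)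
open import Data.Nat.Properties
open import Data.Nat.ListAction.Properties using (product-↭)
open import Data.Product using (_×_; _,_)
open import Data.Product.Properties using (≡-dec)
open import Data.List using (List; []; _∷_; _++_; length; filter; upTo; cartesianProduct; cartesianProductWith)
open import Data.List.Properties using (length-map; length-++; length-++-sucʳ; length-upTo; map-∘; map-cong-local)
open import Data.List.Membership.Propositional using (_∈_)
open import Data.List.Membership.Propositional.Properties
open import Data.List.Membership.Propositional.Properties.WithK using (unique∧set⇒bag)
open import Data.List.Membership.DecPropositional (≡-dec _≟_ (≡-dec _≟_ _≟_)) using (_∈?_)
open import Data.List.Relation.Binary.Subset.Propositional using (_⊆_)
open import Data.List.Relation.Binary.Permutation.Propositional using (_↭_)
open import Data.List.Relation.Binary.Permutation.Propositional.Properties as ↭ using (∈-resp-↭; shift)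
open import Data.List.Relation.Binary.BagAndSetEquality using (∼bag⇒↭)
open import Data.List.Relation.Unary.All as All using (All; []; _∷_)
open import Data.List.Relation.Unary.All.Properties as All using ()
open import Data.List.Relation.Unary.Any using (here; there)
open import Data.List.Relation.Unary.Unique.Propositional using (Unique; []; _∷_)
open import Data.List.Relation.Unary.Unique.Propositional.Properties using (map⁺; upTo⁺; filter⁺; cartesianProduct⁺)
open import Function using (_∘_)
open import Function.Bundles using (mk⇔)
open import Relation.Binary.PropositionalEquality
open import Relation.Binary.Definitions using (DecidableEquality)
open import Relation.Nullary using (yes; no)
open import Relation.Nullary.Negation using (contradiction)

module _ {A : Set} where

  ∈-unshift : ∀ {z x : A} as bs → z ∈ as ++ x ∷ bs → z ≢ x → z ∈ as ++ bs
  ∈-unshift {x = x} as bs z∈ z≢x with ∈-resp-↭ (shift x as bs) z∈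
  ... | here z≡x  = contradiction z≡x z≢x
  ... | there z∈′ = z∈′

  unique-⊆⇒length≤ : ∀ {xs ys : List A} → Unique xs → xs ⊆ ys → length xs ≤ length ys
  unique-⊆⇒length≤ {[]}     _          _     = z≤n
  unique-⊆⇒length≤ {x ∷ xs} (x∉ ∷ xs!) x∷xs⊆ys with ∈-∃++ (x∷xs⊆ys (here refl))
  ... | as , bs , refl = subst (suc (length xs) ≤_) (sym (length-++-sucʳ as x bs))
    (s≤s (unique-⊆⇒length≤ xs! λ z∈ →
      ∈-unshift as bs (x∷xs⊆ys (there z∈)) λ { refl → All.lookup x∉ z∈ refl }))

  unique-map⁺ : ∀ {B : Set} {f : A → B} {xs} → Unique xs →
    (∀ {x y} → x ∈ xs → y ∈ xs → f x ≡ f y → x ≡ y) → Unique (map f xs)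
  unique-map⁺ {xs = []}     []         _   = []
  unique-map⁺ {xs = x ∷ xs} (x∉ ∷ xs!) inj =
    All.map⁺ (All.tabulate λ y∈ fx≡fy → All.lookup x∉ y∈ (inj (here refl) (there y∈) fx≡fy))
    ∷ unique-map⁺ xs! (λ x∈ y∈ → inj (there x∈) (there y∈))

  involution⇒map-↭ : ∀ {f : A → A} {xs} → Unique xs →
    (∀ {x} → x ∈ xs → f x ∈ xs) → (∀ {x} → x ∈ xs → f (f x) ≡ x) → map f xs ↭ xs
  involution⇒map-↭ {f} {xs} xs! closed involutive =
    ∼bag⇒↭ (unique∧set⇒bag (unique-map⁺ xs! injective) xs! (mk⇔ to from))
    where
    injective : ∀ {x y} → x ∈ xs → y ∈ xs → f x ≡ f y → x ≡ y
    injective x∈ y∈ fx≡fy = trans (sym (involutive x∈)) (trans (cong f fx≡fy) (involutive y∈))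
    to : map f xs ⊆ xs
    to z∈ with x , x∈ , refl ← ∈-map⁻ f z∈ = closed x∈
    from : xs ⊆ map f xs
    from z∈ = subst (_∈ map f xs) (involutive z∈) (∈-map⁺ f (closed z∈))

  product-map-mono : ∀ {f g : A → ℕ} xs → (∀ {x} → x ∈ xs → f x ≤ g x) →
    product (map f xs) ≤ product (map g xs)
  product-map-mono []       _   = ≤-refl
  product-map-mono (x ∷ xs) f≤g = *-mono-≤ (f≤g (here refl)) (product-map-mono xs (f≤g ∘ there))

  product-map-* : ∀ (f g : A → ℕ) xs →
    product (map (λ x → f x * g x) xs) ≡ product (map f xs) * product (map g xs)
  product-map-* f g []       = refl
  product-map-* f g (x ∷ xs) = trans (cong (f x * g x *_) (product-map-* f g xs))
    ([m*n]*[o*p]≡[m*o]*[n*p] (f x) (g x) (product (map f xs)) (product (map g xs)))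

  product-map-*³ : ∀ (f g h : A → ℕ) xs →
    product (map (λ x → f x * (g x * h x)) xs)
      ≡ product (map f xs) * (product (map g xs) * product (map h xs))
  product-map-*³ f g h xs =
    trans (product-map-* f _ xs) (cong (product (map f xs) *_) (product-map-* g h xs))

length-cartesianProductWith : ∀ {A B C : Set} (f : A → B → C) xs ys →
  length (cartesianProductWith f xs ys) ≡ length xs * length ys
length-cartesianProductWith f []       ys = refl
length-cartesianProductWith f (x ∷ xs) ys = trans (length-++ (map (f x) ys))
  (cong₂ _+_ (length-map (f x) ys) (length-cartesianProductWith f xs ys))

n<m⇒m∸1+n<m : ∀ {m n} → n < m → m ∸ suc n < m
n<m⇒m∸1+n<m {suc m} {n} _ = s≤s (m∸n≤m m n)

n<m⇒m∸1+[m∸1+n]≡n : ∀ {m n} → n < m → m ∸ suc (m ∸ suc n) ≡ n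
n<m⇒m∸1+[m∸1+n]≡n {suc m} (s≤s n≤m) = m∸[m∸n]≡n n≤m

n<m⇒1+[m∸1+n]≡m∸n : ∀ {m n} → n < m → suc (m ∸ suc n) ≡ m ∸ n
n<m⇒1+[m∸1+n]≡m∸n {suc m} (s≤s n≤m) = sym (+-∸-assoc 1 n≤m)

box : ℕ → ℕ → ℕ → List Point
box a b c = cartesianProduct (upTo a) (cartesianProduct (upTo b) (upTo c))

length-box : ∀ a b c → length (box a b c) ≡ a * (b * c)
length-box a b c =
  trans (length-cartesianProductWith _,_ (upTo a) (cartesianProduct (upTo b) (upTo c)))
    (cong₂ _*_ (length-upTo a)
      (trans (length-cartesianProductWith _,_ (upTo b) (upTo c)) (cong₂ _*_ (length-upTo b) (length-upTo c))))

unique-box : ∀ a b c → Unique (box a b c)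
unique-box a b c = cartesianProduct⁺ (upTo⁺ a) (cartesianProduct⁺ (upTo⁺ b) (upTo⁺ c))

∈-box⁺ : ∀ {a b c p q r} → p < a → q < b → r < c → (p , q , r) ∈ box a b c
∈-box⁺ p<a q<b r<c =
  ∈-cartesianProduct⁺ (∈-upTo⁺ p<a) (∈-cartesianProduct⁺ (∈-upTo⁺ q<b) (∈-upTo⁺ r<c))

∈-box⁻ : ∀ {a b c p q r} → (p , q , r) ∈ box a b c → p < a × q < b × r < c
∈-box⁻ {a} {b} {c} pqr∈ with p∈ , qr∈ ← ∈-cartesianProduct⁻ (upTo a) _ pqr∈
                       with q∈ , r∈ ← ∈-cartesianProduct⁻ (upTo b) (upTo c) qr∈ =
  ∈-upTo⁻ p∈ , ∈-upTo⁻ q∈ , ∈-upTo⁻ r∈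

record Axis : Set where
  field
    coord      : Point → ℕ
    base       : Point → ℕ × ℕ
    at         : ℕ → ℕ × ℕ → Point
    coord-at   : ∀ p r → coord (at p r) ≡ p
    base-at    : ∀ p r → base (at p r) ≡ r
    at-η       : ∀ x → at (coord x) (base x) ≡ x
    at-mono    : ∀ {p q} r → q ≤ p → at q r ≼ at p r
    coord-mono : ∀ {x y} → x ≼ y → coord x ≤ coord y
    at-base-≼  : ∀ {x y} → x ≼ y → at (coord y) (base x) ≼ y

axis₁ axis₂ axis₃ : Axis
axis₁ = record
  { coord = λ { (i , j , k) → i } ; base = λ { (i , j , k) → j , k } ; at = λ { p (j , k) → p , j , k }
  ; coord-at = λ _ _ → refl ; base-at = λ _ _ → refl ; at-η = λ _ → refl
  ; at-mono = λ _ q≤p → q≤p , ≤-refl , ≤-refl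
  ; coord-mono = λ { (u , _ , _) → u }
  ; at-base-≼ = λ { (_ , v , w) → ≤-refl , v , w } }
axis₂ = record
  { coord = λ { (i , j , k) → j } ; base = λ { (i , j , k) → i , k } ; at = λ { p (i , k) → i , p , k }
  ; coord-at = λ _ _ → refl ; base-at = λ _ _ → refl ; at-η = λ _ → refl
  ; at-mono = λ _ q≤p → ≤-refl , q≤p , ≤-refl
  ; coord-mono = λ { (_ , v , _) → v }
  ; at-base-≼ = λ { (u , _ , w) → u , ≤-refl , w } }
axis₃ = record
  { coord = λ { (i , j , k) → k } ; base = λ { (i , j , k) → i , j } ; at = λ { p (i , j) → i , j , p }
  ; coord-at = λ _ _ → refl ; base-at = λ _ _ → refl ; at-η = λ _ → refl
  ; at-mono = λ _ q≤p → ≤-refl , ≤-refl , q≤p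
  ; coord-mono = λ { (_ , _ , w) → w }
  ; at-base-≼ = λ { (u , v , _) → u , v , ≤-refl } }

module _ (Λ : SolidPartition) (axis : Axis) where
  open Axis axis

  private
    _≟₂_ : DecidableEquality (ℕ × ℕ)
    _≟₂_ = ≡-dec _≟_ _≟_

  column : ℕ × ℕ → List Point
  column r = filter (λ y → base y ≟₂ r) (cells Λ)

  height : ℕ × ℕ → ℕ
  height r = length (column r)

  segment : ℕ → ℕ × ℕ → List Point
  segment n r = map (λ q → at q r) (upTo n)

  length-segment : ∀ n r → length (segment n r) ≡ n
  length-segment n r = trans (length-map _ (upTo n)) (length-upTo n)

  unique-segment : ∀ n r → Unique (segment n r)
  unique-segment n r = map⁺ (λ {p} {q} eq →
    trans (sym (coord-at p r)) (trans (cong coord eq) (coord-at q r))) (upTo⁺ n)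

  at∈⇒<height : ∀ {p r} → at p r ∈ cells Λ → p < height r
  at∈⇒<height {p} {r} at∈ = subst (_≤ height r) (length-segment (suc p) r)
    (unique-⊆⇒length≤ (unique-segment (suc p) r) segment⊆column)
    where
    segment⊆column : segment (suc p) r ⊆ column r
    segment⊆column z∈ with q , q∈ , refl ← ∈-map⁻ _ z∈ =
      ∈-filter⁺ _ (lower Λ at∈ (at-mono r (s≤s⁻¹ (∈-upTo⁻ q∈)))) (base-at q r)

  <height⇒at∈ : ∀ {p r} → p < height r → at p r ∈ cells Λ
  <height⇒at∈ {p} {r} p<h with at p r ∈? cells Λ
  ... | yes at∈ = at∈
  ... | no  at∉ = contradiction p<h (≤⇒≯ (subst (height r ≤_) (length-segment p r)
          (unique-⊆⇒length≤ (filter⁺ _ (unique Λ)) column⊆segment)))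
    where
    -- a cell of the column at or beyond p would put at p r into Λ
    column⊆segment : column r ⊆ segment p r
    column⊆segment {z} z∈ with z∈Λ , refl ← ∈-filter⁻ (λ y → base y ≟₂ r) z∈ with coord z <? p
    ... | yes coord<p = subst (_∈ segment p (base z)) (at-η z) (∈-map⁺ _ (∈-upTo⁺ coord<p))
    ... | no  coord≮p = contradiction
          (lower Λ z∈Λ (subst (at p (base z) ≼_) (at-η z) (at-mono (base z) (≮⇒≥ coord≮p)))) at∉

  coord<height : ∀ {x} → x ∈ cells Λ → coord x < height (base x)
  coord<height {x} x∈ = at∈⇒<height (subst (_∈ cells Λ) (sym (at-η x)) x∈)

  above : Point → ℕ
  above x = height (base x) ∸ coord x

  ∸-coord<above : ∀ {x y} → y ∈ cells Λ → x ≼ y → coord y ∸ coord x < above x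
  ∸-coord<above y∈ x≼y = ∸-monoˡ-< (at∈⇒<height (lower Λ y∈ (at-base-≼ x≼y))) (coord-mono x≼y)

  reflect : Point → Point
  reflect x = at (height (base x) ∸ suc (coord x)) (base x)

  reflect-∈ : ∀ {x} → x ∈ cells Λ → reflect x ∈ cells Λ
  reflect-∈ x∈ = <height⇒at∈ (n<m⇒m∸1+n<m (coord<height x∈))

  reflect-involutive : ∀ {x} → x ∈ cells Λ → reflect (reflect x) ≡ x
  reflect-involutive {x} x∈ = begin
    at (height (base (reflect x)) ∸ suc (coord (reflect x))) (base (reflect x))
      ≡⟨ cong (λ r → at (height r ∸ suc (coord (reflect x))) r) (base-at _ (base x)) ⟩
    at (height (base x) ∸ suc (coord (reflect x))) (base x)
      ≡⟨ cong (λ p → at (height (base x) ∸ suc p) (base x)) (coord-at _ (base x)) ⟩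
    at (height (base x) ∸ suc (height (base x) ∸ suc (coord x))) (base x)
      ≡⟨ cong (λ p → at p (base x)) (n<m⇒m∸1+[m∸1+n]≡n (coord<height x∈)) ⟩
    at (coord x) (base x)
      ≡⟨ at-η x ⟩
    x ∎
    where open ≡-Reasoning

  product-above≡product-suc-coord :
    product (map above (cells Λ)) ≡ product (map (suc ∘ coord) (cells Λ))
  product-above≡product-suc-coord = begin
    product (map above (cells Λ))
      ≡⟨ cong product (map-cong-local (All.tabulate suc-coord-reflect)) ⟩
    product (map (suc ∘ coord ∘ reflect) (cells Λ))
      ≡⟨ cong product (map-∘ (cells Λ)) ⟩
    product (map (suc ∘ coord) (map reflect (cells Λ)))
      ≡⟨ product-↭ (↭.map⁺ _ (involution⇒map-↭ (unique Λ) reflect-∈ reflect-involutive)) ⟩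
    product (map (suc ∘ coord) (cells Λ)) ∎
    where
    open ≡-Reasoning
    suc-coord-reflect : ∀ {x} → x ∈ cells Λ → above x ≡ suc (coord (reflect x))
    suc-coord-reflect {x} x∈ =
      sym (trans (cong suc (coord-at _ (base x))) (n<m⇒1+[m∸1+n]≡m∸n (coord<height x∈)))

translate : Point → Point → Point
translate (i , j , k) (p , q , r) = i + p , j + q , k + r

module _ (Λ : SolidPartition) where
  open Axis using (coord)

  V≤∏above : ∀ x → V Λ x ≤ above Λ axis₁ x * (above Λ axis₂ x * above Λ axis₃ x)
  V≤∏above x = subst (V Λ x ≤_)
    (trans (length-map (translate x) upperBox) (length-box (above Λ axis₁ x) (above Λ axis₂ x) (above Λ axis₃ x)))
    (unique-⊆⇒length≤ (filter⁺ (x ≼?_) (unique Λ)) upper⊆translatedBox)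
    where
    upperBox : List Point
    upperBox = box (above Λ axis₁ x) (above Λ axis₂ x) (above Λ axis₃ x)
    upper⊆translatedBox : filter (x ≼?_) (cells Λ) ⊆ map (translate x) upperBox
    upper⊆translatedBox y∈ with y∈Λ , x≼y@(i≤p , j≤q , k≤r) ← ∈-filter⁻ (x ≼?_) y∈ =
      subst (_∈ map (translate x) upperBox)
        (cong₂ _,_ (m+[n∸m]≡n i≤p) (cong₂ _,_ (m+[n∸m]≡n j≤q) (m+[n∸m]≡n k≤r)))
        (∈-map⁺ (translate x) (∈-box⁺ (∸-coord<above Λ axis₁ y∈Λ x≼y)
          (∸-coord<above Λ axis₂ y∈Λ x≼y) (∸-coord<above Λ axis₃ y∈Λ x≼y)))

  ∏suc-coord≤V* : ∀ {x} → x ∈ cells Λ →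
    suc (coord axis₁ x) * (suc (coord axis₂ x) * suc (coord axis₃ x)) ≤ V* Λ x
  ∏suc-coord≤V* {x@(i , j , k)} x∈ = subst (_≤ V* Λ x) (length-box (suc i) (suc j) (suc k))
    (unique-⊆⇒length≤ (unique-box (suc i) (suc j) (suc k)) lowerBox⊆lower)
    where
    lowerBox⊆lower : box (suc i) (suc j) (suc k) ⊆ filter (_≼? x) (cells Λ)
    lowerBox⊆lower y∈ with p<1+i , q<1+j , r<1+k ← ∈-box⁻ y∈ =
      let y≼x = s≤s⁻¹ p<1+i , s≤s⁻¹ q<1+j , s≤s⁻¹ r<1+k in
      ∈-filter⁺ (_≼? x) (lower Λ x∈ y≼x) y≼x

corollary5p4 : (Λ : SolidPartition) →
    product (map (V Λ) (cells Λ)) ≤ product (map (V* Λ) (cells Λ))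
corollary5p4 Λ = begin
  product (map (V Λ) (cells Λ))
    ≤⟨ product-map-mono (cells Λ) (λ {x} _ → V≤∏above Λ x) ⟩
  product (map (λ x → a₁ x * (a₂ x * a₃ x)) (cells Λ))
    ≡⟨ product-map-*³ a₁ a₂ a₃ (cells Λ) ⟩
  ∏ a₁ * (∏ a₂ * ∏ a₃)
    ≡⟨ cong₂ _*_ (product-above≡product-suc-coord Λ axis₁)
         (cong₂ _*_ (product-above≡product-suc-coord Λ axis₂) (product-above≡product-suc-coord Λ axis₃)) ⟩
  ∏ (suc ∘ coord axis₁) * (∏ (suc ∘ coord axis₂) * ∏ (suc ∘ coord axis₃))
    ≡⟨ product-map-*³ (suc ∘ coord axis₁) (suc ∘ coord axis₂) (suc ∘ coord axis₃) (cells Λ) ⟨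
  product (map (λ x → suc (coord axis₁ x) * (suc (coord axis₂ x) * suc (coord axis₃ x))) (cells Λ))
    ≤⟨ product-map-mono (cells Λ) (∏suc-coord≤V* Λ) ⟩
  product (map (V* Λ) (cells Λ)) ∎
  where
  open ≤-Reasoning
  open Axis using (coord)
  a₁ a₂ a₃ : Point → ℕ
  a₁ = above Λ axis₁
  a₂ = above Λ axis₂
  a₃ = above Λ axis₃
  ∏ : (Point → ℕ) → ℕ
  ∏ f = product (map f (cells Λ))
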